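{- For any graph $U$ and any integers $h,m\ge 1$, $\operatorname{tw}(U^{(h,m)})\le\operatorname{tw}(U)+1$.
   Context: $\operatorname{tw}$ denotes treewidth. For a graph $U$ and integers $h,m\ge 0$, the $(h,m)$-boost $U^{(h,m)}$ has vertex set the disjoint union $L_0\cup\cdots\cup L_m$, where $L_0=\{a_0\}$ is a single vertex and, for each $i\in\{1,\ldots,m\}$ and each $a\in L_{i-1}$, $U^{(h,m)}$ contains $hm+1$ disjoint copies $U_{a,0},\ldots,U_{a,hm}$ of $U$ together with all edges $av$ for $v\in\bigcup_{j=0}^{hm}V(U_{a,j})$; $L_i$ is the union over $a\in L_{i-1}$ of the vertex sets of these copies. There are no other edges. -}

module Defs where

open import Data.Nat using (ℕ; zero; suc; _*_; _≤_)
open import Data.Fin using (Fin)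
open import Data.List using (List; []; _∷_; length)
open import Data.List.Membership.Propositional using (_∈_)
open import Data.List.Relation.Unary.All using (All)
open import Data.List.Relation.Unary.Linked using (Linked)
open import Data.List.Relation.Unary.Unique.Propositional using (Unique)
open import Data.Product using (Σ; ∃; _×_; _,_; proj₁)
open import Data.Sum using (_⊎_; inj₁; inj₂)
open import Data.Empty using (⊥)
open import Data.Unit using (⊤)
open import Relation.Nullary using (¬_)
open import Relation.Binary.PropositionalEquality using (_≡_; refl; cong)

record Graph (V : Set) : Set₁ where
  field
    Adj    : V → V → Set
    sym    : ∀ {x y} → Adj x y → Adj y x
    irrefl : ∀ {x} → ¬ Adj x x
open Graph public

data Walk {V : Set} (R : V → V → Set) (P : V → Set) : V → V → Set where
  here : ∀ {x} → P x → Walk R P x x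
  step : ∀ {x y z} → P x → R x y → Walk R P y z → Walk R P x z

lastOr : {V : Set} → V → List V → V
lastOr x []       = x
lastOr _ (y ∷ ys) = lastOr y ys

Cycle : {V : Set} → (V → V → Set) → Set
Cycle {V} R = Σ V λ x → Σ (List V) λ xs →
  (2 ≤ length xs) × Unique (x ∷ xs) × Linked R (x ∷ xs) × R (lastOr x xs) x

record Tree (N : ℕ) : Set₁ where
  field
    graph     : Graph (Fin (suc N))
    connected : ∀ s t → Walk (Adj graph) (λ _ → ⊤) s t
    acyclic   : ¬ Cycle (Adj graph)
open Tree public

record TreeDecomposition {V : Set} (G : Graph V) (k : ℕ) : Set₁ where
  field
    N        : ℕ
    tree     : Tree N
    bag      : Fin (suc N) → List V
    width≤   : ∀ t → length (bag t) ≤ suc k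
    vertex   : ∀ v → ∃ λ t → v ∈ bag t
    edge     : ∀ u v → Adj G u v → ∃ λ t → (u ∈ bag t) × (v ∈ bag t)
    subtree  : ∀ v s t → v ∈ bag s → v ∈ bag t →
               Walk (Adj (graph tree)) (λ x → v ∈ bag x) s t

TwAtMost : {V : Set} → Graph V → ℕ → Set₁
TwAtMost G k = TreeDecomposition G k

-- A vertex of L_i is encoded as a list of length i of pairs (j , v):
-- the list (j , v) ∷ w (w ∈ L_{i-1}) is the copy of v in U_{w,j}.
-- The root a₀ is [].

BoostLabel : ℕ → ℕ → ℕ → Set
BoostLabel n h m = Fin (suc (h * m)) × Fin n

BoostV : ℕ → ℕ → ℕ → Set
BoostV n h m = Σ (List (BoostLabel n h m)) λ w → length w ≤ m

data BoostAdj' {n : ℕ} (U : Graph (Fin n)) (h m : ℕ) :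
               List (BoostLabel n h m) → List (BoostLabel n h m) → Set where
  parent : ∀ w j v → BoostAdj' U h m w ((j , v) ∷ w)
  child  : ∀ w j v → BoostAdj' U h m ((j , v) ∷ w) w
  copy   : ∀ w j u v → Adj U u v → BoostAdj' U h m ((j , u) ∷ w) ((j , v) ∷ w)

private
  boostSym : ∀ {n} {h m : ℕ} (U : Graph (Fin n)) {x y : List (BoostLabel n h m)} →
             BoostAdj' U h m x y → BoostAdj' U h m y x
  boostSym U (parent w j v) = child w j v
  boostSym U (child w j v)  = parent w j v
  boostSym U (copy w j u v a) = copy w j v u (sym U a)

  boostIrrefl : ∀ {n} {h m : ℕ} (U : Graph (Fin n)) {x : List (BoostLabel n h m)} →
                ¬ BoostAdj' U h m x x
  boostIrrefl U (copy w j u .u a) = irrefl U a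

boost : ∀ {n} → Graph (Fin n) → (h m : ℕ) → Graph (BoostV n h m)
boost U h m = record
  { Adj    = λ x y → BoostAdj' U h m (proj₁ x) (proj₁ y)
  ; sym    = boostSym U
  ; irrefl = boostIrrefl U
  }

module Submission where

-- From a tree decomposition of U of width k we build one of the boost of
-- width k + 1, bottom-up.  The part of the boost below a vertex c is
-- decomposed by a single bag {c} to which, for every copy U_{c,j}, we glue
-- U's decomposition with c added to each bag (width k + 1); to the node of
-- that copy whose bag holds v we glue, recursively, the decomposition of the
-- part below the copy of v.

open import Defs renaming (sym to Adj-sym)
open import Data.Nat using (ℕ; zero; suc; _+_; _*_; _≤_; z≤n; s≤s)
open import Data.Nat.Properties
  using (suc-injective; ≤-refl; ≤-trans; ≤-irrelevant; m≤n⇒m≤1+n; n≤1+n; 1+n≰n; m≤n+m; +-suc; +-identityʳ)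
open import Data.Fin using (Fin; zero; suc; _↑ˡ_; _↑ʳ_; splitAt; join; _≟_)
open import Data.Fin.Properties using (splitAt-↑ˡ; splitAt-↑ʳ; splitAt⁻¹-↑ˡ; splitAt⁻¹-↑ʳ; join-splitAt)
  renaming (suc-injective to Fin-suc-injective)
open import Data.List using (List; []; _∷_; length; map; _++_)
open import Data.List.Properties using (length-map)
open import Data.List.Membership.Propositional using (_∈_)
open import Data.List.Membership.Propositional.Properties using (∈-∃++; ∈-map⁺; ∈-map⁻)
open import Data.List.Relation.Unary.Any using (here; there; any?)
open import Data.List.Relation.Unary.All as All using (All; []; _∷_)
open import Data.List.Relation.Unary.All.Properties.Core using (¬Any⇒All¬)
open import Data.List.Relation.Unary.Linked using (Linked; [-]; _∷_)
import Data.List.Relation.Unary.Linked.Properties as Linked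
open import Data.List.Relation.Unary.Unique.Propositional using (Unique; _∷_)
import Data.List.Relation.Unary.Unique.Propositional.Properties as Unique
import Data.List.Relation.Binary.Permutation.Setoid.Properties as Perm
open import Data.Product using (∃; _×_; _,_; proj₁; proj₂)
open import Data.Sum using (_⊎_; inj₁; inj₂; [_,_]′)
open import Data.Sum.Properties using (≡-dec)
open import Data.Empty using (⊥; ⊥-elim)
open import Data.Unit using (⊤; tt)
open import Function using (_on_; _∘_)
open import Relation.Nullary using (¬_; yes; no)
open import Relation.Binary.Definitions using (DecidableEquality)
open import Relation.Binary.PropositionalEquality
  using (_≡_; _≢_; refl; sym; trans; cong; subst; subst₂; setoid)

module _ {V W : Set} {R : V → V → Set} {P : V → Set} {R′ : W → W → Set} {P′ : W → Set} where

  mapWalk : (f : V → W) → (∀ {x y} → R x y → R′ (f x) (f y)) → (∀ {x} → P x → P′ (f x)) →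
            ∀ {s t} → Walk R P s t → Walk R′ P′ (f s) (f t)
  mapWalk f hom pres (here p)     = here (pres p)
  mapWalk f hom pres (step p r w) = step (pres p) (hom r) (mapWalk f hom pres w)

module _ {V : Set} {R : V → V → Set} {P : V → Set} where

  bridgeWalks : ∀ {s x y t} → Walk R P s x → R x y → Walk R P y t → Walk R P s t
  bridgeWalks (here p)     r w = step p r w
  bridgeWalks (step p q v) r w = step p q (bridgeWalks v r w)

  weakenWalk : {Q : V → Set} → (∀ {x} → P x → Q x) → ∀ {s t} → Walk R P s t → Walk R Q s t
  weakenWalk = mapWalk (λ x → x) (λ r → r)

IsCycle : {V : Set} → (V → V → Set) → V → List V → Set
IsCycle R x xs = (2 ≤ length xs) × Unique (x ∷ xs) × Linked R (x ∷ xs) × R (lastOr x xs) x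

module _ {V : Set} where

  lastOr-∈ : ∀ (x : V) xs → lastOr x xs ∈ x ∷ xs
  lastOr-∈ x []       = here refl
  lastOr-∈ x (y ∷ ys) = there (lastOr-∈ y ys)

  lastOr-++ : ∀ (x : V) ys zs → lastOr x (ys ++ zs) ≡ lastOr (lastOr x ys) zs
  lastOr-++ x []       zs = refl
  lastOr-++ x (y ∷ ys) zs = lastOr-++ y ys zs

  lastOr-map : {W : Set} (f : V → W) → ∀ x xs → lastOr (f x) (map f xs) ≡ f (lastOr x xs)
  lastOr-map f x []       = refl
  lastOr-map f x (y ∷ ys) = lastOr-map f y ys

  module _ {R : V → V → Set} where

    splitLinked : ∀ x ys zs → Linked R (x ∷ ys ++ zs) → Linked R (x ∷ ys) × Linked R (lastOr x ys ∷ zs)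
    splitLinked x []       zs l       = [-] , l
    splitLinked x (y ∷ ys) zs (r ∷ l) with splitLinked y ys zs l
    ... | l₁ , l₂ = r ∷ l₁ , l₂

    glueLinked : ∀ x ys zs → Linked R (x ∷ ys) → Linked R (lastOr x ys ∷ zs) → Linked R (x ∷ ys ++ zs)
    glueLinked x []       zs l₁       l₂ = l₂
    glueLinked x (y ∷ ys) zs (r ∷ l₁) l₂ = r ∷ glueLinked y ys zs l₁ l₂

    rotateCycle : ∀ {x ys y zs} → IsCycle R x (ys ++ y ∷ zs) → IsCycle R y (zs ++ x ∷ ys)
    rotateCycle {x} {ys} {y} {zs} (long , unique , linked , closing) with splitLinked x ys (y ∷ zs) linked
    ... | xys , (last→y ∷ yzs) =
      subst (2 ≤_) sameLength long ,
      Perm.Unique-resp-↭ (setoid V) (Perm.++-comm (setoid V) (x ∷ ys) (y ∷ zs)) unique ,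
      glueLinked y zs (x ∷ ys) yzs (closing′ ∷ xys) ,
      subst (λ z → R z y) (sym (lastOr-++ y zs (x ∷ ys))) last→y
      where
        sameLength : length (ys ++ y ∷ zs) ≡ length (zs ++ x ∷ ys)
        sameLength = suc-injective (Perm.xs↭ys⇒|xs|≡|ys| (setoid V) (Perm.++-comm (setoid V) (x ∷ ys) (y ∷ zs)))
        closing′ : R (lastOr y zs) x
        closing′ = subst (λ z → R z x) (lastOr-++ x ys (y ∷ zs)) closing

module _ {V W : Set} (f : V → W) where

  inImage⇒map : ∀ {zs} → All (λ z → ∃ λ v → z ≡ f v) zs → ∃ λ vs → zs ≡ map f vs
  inImage⇒map []                 = [] , refl
  inImage⇒map ((v , refl) ∷ ps) with inImage⇒map ps
  ... | vs , refl = v ∷ vs , refl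

module _ {V W : Set} {R : W → W → Set} (f : V → W) where

  mapCycle : (∀ {x y} → f x ≡ f y → x ≡ y) → ∀ {x xs} → IsCycle (R on f) x xs → IsCycle R (f x) (map f xs)
  mapCycle inj {x} {xs} (long , unique , linked , closing) =
    subst (2 ≤_) (sym (length-map f xs)) long ,
    Unique.map⁺ inj unique ,
    Linked.map⁺ linked ,
    subst (λ z → R z (f x)) (sym (lastOr-map f x xs)) closing

  unmapCycle : ∀ {x xs} → IsCycle R (f x) (map f xs) → IsCycle (R on f) x xs
  unmapCycle {x} {xs} (long , unique , linked , closing) =
    subst (2 ≤_) (length-map f xs) long ,
    Unique.map⁻ unique ,
    Linked.map⁻ linked ,
    subst (λ z → R z (f x)) (lastOr-map f x xs) closing

-- If both are acyclic (and equality is decidable), so is the join: a cycle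
-- avoiding inj₁ a cannot cross the bridge, and a cycle through inj₁ a
-- would have to leave and re-enter it via the same bridge vertex inj₂ b.

module BridgeJoin {A B : Set} (RA : A → A → Set) (RB : B → B → Set) (a : A) (b : B) where

  Bridge : A ⊎ B → A ⊎ B → Set
  Bridge (inj₁ x) (inj₁ y) = RA x y
  Bridge (inj₂ x) (inj₂ y) = RB x y
  Bridge (inj₁ x) (inj₂ y) = (x ≡ a) × (y ≡ b)
  Bridge (inj₂ x) (inj₁ y) = (y ≡ a) × (x ≡ b)

  OnLeft OnRight : A ⊎ B → Set
  OnLeft z  = ∃ λ x → z ≡ inj₁ x
  OnRight z = ∃ λ y → z ≡ inj₂ y

  side : ∀ z → OnLeft z ⊎ OnRight z
  side (inj₁ x) = inj₁ (x , refl)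
  side (inj₂ y) = inj₂ (y , refl)

  noCrossing : ∀ {z z′} → Bridge z z′ → inj₁ a ≢ z → inj₁ a ≢ z′ →
               (OnLeft z × OnLeft z′) ⊎ (OnRight z × OnRight z′)
  noCrossing {inj₁ x} {inj₁ y} _ _ _ = inj₁ ((x , refl) , (y , refl))
  noCrossing {inj₂ x} {inj₂ y} _ _ _ = inj₂ ((x , refl) , (y , refl))
  noCrossing {inj₁ x} {inj₂ y} (x≡a , _) a≢z _  = ⊥-elim (a≢z (cong inj₁ (sym x≡a)))
  noCrossing {inj₂ x} {inj₁ y} (y≡a , _) _ a≢z′ = ⊥-elim (a≢z′ (cong inj₁ (sym y≡a)))

  oneSide : ∀ z zs → Linked Bridge (z ∷ zs) → All (inj₁ a ≢_) (z ∷ zs) →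
            All OnLeft (z ∷ zs) ⊎ All OnRight (z ∷ zs)
  oneSide z [] _ _ with side z
  ... | inj₁ l = inj₁ (l ∷ [])
  ... | inj₂ r = inj₂ (r ∷ [])
  oneSide z (z′ ∷ zs) (r ∷ l) (a≢z ∷ a≢zs) with noCrossing r a≢z (All.head a≢zs) | oneSide z′ zs l a≢zs
  ... | inj₁ (lz , _)         | inj₁ lefts           = inj₁ (lz ∷ lefts)
  ... | inj₂ (rz , _)         | inj₂ rights          = inj₂ (rz ∷ rights)
  ... | inj₁ (_ , (x , refl)) | inj₂ ((_ , ()) ∷ _)
  ... | inj₂ (_ , (y , refl)) | inj₁ ((_ , ()) ∷ _)

  leftCycle : ∀ {x xs} → All OnLeft (x ∷ xs) → IsCycle Bridge x xs → Cycle RA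
  leftCycle lefts c with inImage⇒map inj₁ lefts
  ... | x ∷ xs , refl = x , xs , unmapCycle {R = Bridge} inj₁ c

  rightCycle : ∀ {x xs} → All OnRight (x ∷ xs) → IsCycle Bridge x xs → Cycle RB
  rightCycle rights c with inImage⇒map inj₂ rights
  ... | y ∷ ys , refl = y , ys , unmapCycle {R = Bridge} inj₂ c

  bridgeEnd : ∀ {z} → OnRight z → Bridge (inj₁ a) z → z ≡ inj₂ b
  bridgeEnd (y , refl) (_ , y≡b) = cong inj₂ y≡b

  bridgeEnd′ : ∀ {z} → OnRight z → Bridge z (inj₁ a) → z ≡ inj₂ b
  bridgeEnd′ (y , refl) (_ , y≡b) = cong inj₂ y≡b

  module _ (acyclicA : ¬ Cycle RA) (acyclicB : ¬ Cycle RB) where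

    -- After inj₁ a, a cycle avoids inj₁ a, hence stays on one side: on the left
    -- it is a cycle of RA; on the right its second and last vertices would
    -- both have to be inj₂ b.
    noCycleThroughA : ∀ xs → ¬ IsCycle Bridge (inj₁ a) xs
    noCycleThroughA []      (() , _)
    noCycleThroughA (_ ∷ []) (s≤s () , _)
    noCycleThroughA (z ∷ z′ ∷ zs) c@(_ , (a∉ ∷ z∉ ∷ _) , (r ∷ l) , closing)
      with oneSide z (z′ ∷ zs) l a∉
    ... | inj₁ lefts  = acyclicA (leftCycle ((a , refl) ∷ lefts) c)
    ... | inj₂ rights = All.lookup z∉ (lastOr-∈ z′ zs)
      (trans (bridgeEnd (All.head rights) r)
             (sym (bridgeEnd′ (All.lookup rights (there (lastOr-∈ z′ zs))) closing)))

    -- A cycle through inj₁ a can be rotated to start there; any other cycle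
    -- stays on one side.
    acyclicBridge : DecidableEquality A → DecidableEquality B → ¬ Cycle Bridge
    acyclicBridge _≟A_ _≟B_ (x , xs , c) with any? (≡-dec _≟A_ _≟B_ (inj₁ a)) (x ∷ xs)
    ... | yes (here refl) = noCycleThroughA xs c
    ... | yes (there a∈xs) with ∈-∃++ a∈xs
    ...   | ys , zs , refl = noCycleThroughA _ (rotateCycle c)
    acyclicBridge _ _ (x , xs , c@(_ , _ , linked , _)) | no a∉
      with oneSide x xs linked (¬Any⇒All¬ (x ∷ xs) a∉)
    ... | inj₁ lefts  = acyclicA (leftCycle lefts c)
    ... | inj₂ rights = acyclicB (rightCycle rights c)

module TreeJoin {A B : ℕ} (TA : Tree A) (a : Fin (suc A)) (TB : Tree B) (b : Fin (suc B)) where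

  open BridgeJoin (Adj (graph TA)) (Adj (graph TB)) a b

  split : Fin (suc A + suc B) → Fin (suc A) ⊎ Fin (suc B)
  split = splitAt (suc A)

  inl : Fin (suc A) → Fin (suc A + suc B)
  inl x = x ↑ˡ suc B

  inr : Fin (suc B) → Fin (suc A + suc B)
  inr y = suc A ↑ʳ y

  split-inl : ∀ x → split (inl x) ≡ inj₁ x
  split-inl x = splitAt-↑ˡ (suc A) x (suc B)

  split-inr : ∀ y → split (inr y) ≡ inj₂ y
  split-inr y = splitAt-↑ʳ (suc A) (suc B) y

  split-injective : ∀ {s t} → split s ≡ split t → s ≡ t
  split-injective {s} {t} e =
    trans (sym (join-splitAt (suc A) (suc B) s))
          (trans (cong (join (suc A) (suc B)) e) (join-splitAt (suc A) (suc B) t))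

  data View : Fin (suc A + suc B) → Set where
    left  : ∀ x → View (inl x)
    right : ∀ y → View (inr y)

  view : ∀ s → View s
  view s with split s in eq
  ... | inj₁ x = subst View (splitAt⁻¹-↑ˡ eq) (left x)
  ... | inj₂ y = subst View (splitAt⁻¹-↑ʳ eq) (right y)

  Bridge-sym : ∀ {u v} → Bridge u v → Bridge v u
  Bridge-sym {inj₁ x} {inj₁ y} r = Adj-sym (graph TA) r
  Bridge-sym {inj₂ x} {inj₂ y} r = Adj-sym (graph TB) r
  Bridge-sym {inj₁ x} {inj₂ y} r = r
  Bridge-sym {inj₂ x} {inj₁ y} r = r

  Bridge-irrefl : ∀ {u} → ¬ Bridge u u
  Bridge-irrefl {inj₁ x} = irrefl (graph TA)
  Bridge-irrefl {inj₂ y} = irrefl (graph TB)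

  joinGraph : Graph (Fin (suc A + suc B))
  joinGraph = record
    { Adj    = Bridge on split
    ; sym    = λ {s t} → Bridge-sym {split s} {split t}
    ; irrefl = λ {s} → Bridge-irrefl {split s}
    }

  private
    J : Fin (suc A + suc B) → Fin (suc A + suc B) → Set
    J = Adj joinGraph

  crossLR : J (inl a) (inr b)
  crossLR = subst₂ Bridge (sym (split-inl a)) (sym (split-inr b)) (refl , refl)

  crossRL : J (inr b) (inl a)
  crossRL = Bridge-sym {split (inl a)} {split (inr b)} crossLR

  liftLeft : {P : Fin (suc A) → Set} {P′ : Fin (suc A + suc B) → Set} → (∀ {x} → P x → P′ (inl x)) →
             ∀ {s t} → Walk (Adj (graph TA)) P s t → Walk J P′ (inl s) (inl t)
  liftLeft = mapWalk inl (λ {x} {y} r → subst₂ Bridge (sym (split-inl x)) (sym (split-inl y)) r)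

  liftRight : {P : Fin (suc B) → Set} {P′ : Fin (suc A + suc B) → Set} → (∀ {y} → P y → P′ (inr y)) →
              ∀ {s t} → Walk (Adj (graph TB)) P s t → Walk J P′ (inr s) (inr t)
  liftRight = mapWalk inr (λ {x} {y} r → subst₂ Bridge (sym (split-inr x)) (sym (split-inr y)) r)

  joinConnected : ∀ s t → Walk J (λ _ → ⊤) s t
  joinConnected s t with view s | view t
  ... | left x  | left y  = liftLeft _ (connected TA x y)
  ... | right x | right y = liftRight _ (connected TB x y)
  ... | left x  | right y = bridgeWalks (liftLeft _ (connected TA x a)) crossLR (liftRight _ (connected TB b y))
  ... | right x | left y  = bridgeWalks (liftRight _ (connected TB x b)) crossRL (liftLeft _ (connected TA a y))

  joinTree : Tree (A + suc B)
  joinTree = record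
    { graph     = joinGraph
    ; connected = joinConnected
    ; acyclic   = λ { (x , xs , c) → acyclicBridge (acyclic TA) (acyclic TB) _≟_ _≟_
                        (split x , map split xs , mapCycle split split-injective c) }
    }

pointTree : Tree 0
pointTree = record
  { graph     = record { Adj = λ _ _ → ⊥ ; sym = λ () ; irrefl = λ () }
  ; connected = λ { zero zero → here tt }
  ; acyclic   = λ { (_ , _ , _ , _ , () ∷ _ , _) }
  }

record BaggedTree (X : Set) : Set₁ where
  constructor bagged
  field
    N    : ℕ
    tree : Tree N
    bag  : Fin (suc N) → List X
open BaggedTree public

Node : {X : Set} → BaggedTree X → Set
Node P = Fin (suc (N P))

module _ {X : Set} where

  SubtreeProperty : BaggedTree X → Set
  SubtreeProperty P = ∀ v s t → v ∈ bag P s → v ∈ bag P t →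
                      Walk (Adj (graph (tree P))) (λ x → v ∈ bag P x) s t

  AllBags : (List X → Set) → BaggedTree X → Set
  AllBags Q P = ∀ t → Q (bag P t)

  record _⊑_ (P P′ : BaggedTree X) : Set where
    constructor bagsAmong
    field reBag : ∀ s → ∃ λ t → bag P′ t ≡ bag P s
  open _⊑_

  ⊑-refl : ∀ {P} → P ⊑ P
  ⊑-refl = bagsAmong λ s → s , refl

  ⊑-trans : ∀ {P P′ P″} → P ⊑ P′ → P′ ⊑ P″ → P ⊑ P″
  ⊑-trans P⊑P′ P′⊑P″ = bagsAmong λ s →
    let (t , e) = reBag P⊑P′ s ; (u , e′) = reBag P′⊑P″ t in u , trans e′ e

  Covered : BaggedTree X → X → X → Set
  Covered P x y = ∃ λ t → x ∈ bag P t × y ∈ bag P t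

  covered-⊑ : ∀ {P P′ x y} → P ⊑ P′ → Covered P x y → Covered P′ x y
  covered-⊑ P⊑P′ (s , xs , ys) =
    let (t , e) = reBag P⊑P′ s in t , subst (_ ∈_) (sym e) xs , subst (_ ∈_) (sym e) ys

  singleton : X → BaggedTree X
  singleton x = bagged 0 pointTree (λ _ → x ∷ [])

  singleton-subtree : ∀ x → SubtreeProperty (singleton x)
  singleton-subtree x v zero zero vs _ = here vs

  -- The condition under which gluing Q's root to node a of P preserves the
  -- subtree property: every shared element lies in both glued bags.
  SharedThrough : (P : BaggedTree X) → Node P → BaggedTree X → Set
  SharedThrough P a Q = ∀ v s t → v ∈ bag P s → v ∈ bag Q t → v ∈ bag P a × v ∈ bag Q zero

module Join {X : Set} (P : BaggedTree X) (a : Node P) (Q : BaggedTree X) where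

  open TreeJoin (tree P) a (tree Q) zero public using (inl)
  open TreeJoin (tree P) a (tree Q) zero
    using (inr; split-inl; split-inr; left; right; view; liftLeft; liftRight; crossLR; crossRL; joinTree)

  joined : BaggedTree X
  joined = bagged (N P + suc (N Q)) joinTree (λ s → [ bag P , bag Q ]′ (splitAt (suc (N P)) s))

  bag-inl : ∀ x → bag joined (inl x) ≡ bag P x
  bag-inl x = cong [ bag P , bag Q ]′ (split-inl x)

  bag-inr : ∀ y → bag joined (inr y) ≡ bag Q y
  bag-inr y = cong [ bag P , bag Q ]′ (split-inr y)

  left⊑ : P ⊑ joined
  left⊑ = bagsAmong λ x → inl x , bag-inl x

  right⊑ : Q ⊑ joined
  right⊑ = bagsAmong λ y → inr y , bag-inr y

  joined-all : ∀ R → AllBags R P → AllBags R Q → AllBags R joined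
  joined-all R allP allQ s with view s
  ... | left x  = subst R (sym (bag-inl x)) (allP x)
  ... | right y = subst R (sym (bag-inr y)) (allQ y)

  bag-cases : ∀ s → (∃ λ x → bag joined s ≡ bag P x) ⊎ (∃ λ y → bag joined s ≡ bag Q y)
  bag-cases s with view s
  ... | left x  = inj₁ (x , bag-inl x)
  ... | right y = inj₂ (y , bag-inr y)

  module _ {v : X} where
    intoL : ∀ {x} → v ∈ bag P x → v ∈ bag joined (inl x)
    intoL {x} = subst (v ∈_) (sym (bag-inl x))

    intoR : ∀ {y} → v ∈ bag Q y → v ∈ bag joined (inr y)
    intoR {y} = subst (v ∈_) (sym (bag-inr y))

    fromL : ∀ {x} → v ∈ bag joined (inl x) → v ∈ bag P x
    fromL {x} = subst (v ∈_) (bag-inl x)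

    fromR : ∀ {y} → v ∈ bag joined (inr y) → v ∈ bag Q y
    fromR {y} = subst (v ∈_) (bag-inr y)

  -- An element's nodes on the two sides are connected through the new edge.
  joined-subtree : SubtreeProperty P → SubtreeProperty Q → SharedThrough P a Q → SubtreeProperty joined
  joined-subtree subP subQ shared v s t vs vt with view s | view t
  ... | left x  | left y  = liftLeft intoL (subP v x y (fromL vs) (fromL vt))
  ... | right x | right y = liftRight intoR (subQ v x y (fromR vs) (fromR vt))
  ... | left x  | right y =
    let (va , v0) = shared v x y (fromL vs) (fromR vt)
    in bridgeWalks (liftLeft intoL (subP v x a (fromL vs) va)) crossLR (liftRight intoR (subQ v zero y v0 (fromR vt)))
  ... | right x | left y  =
    let (va , v0) = shared v y x (fromL vt) (fromR vs)
    in bridgeWalks (liftRight intoR (subQ v x zero (fromR vs) v0)) crossRL (liftLeft intoL (subP v a y va (fromL vt)))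

module _ {X : Set} where

  attach : (B : BaggedTree X) (K : ℕ) → (Fin K → BaggedTree X) → (Fin K → Node B) → BaggedTree X
  attach B zero    F f = B
  attach B (suc K) F f = attach (Join.joined B (f zero) (F zero)) K (F ∘ suc) (Join.inl B (f zero) (F zero) ∘ f ∘ suc)

  attach-root : ∀ B K F f → bag (attach B K F f) zero ≡ bag B zero
  attach-root B zero    F f = refl
  attach-root B (suc K) F f = attach-root _ K (F ∘ suc) _

  attach-base : ∀ B K F f → B ⊑ attach B K F f
  attach-base B zero    F f = ⊑-refl
  attach-base B (suc K) F f = ⊑-trans (Join.left⊑ B (f zero) (F zero)) (attach-base _ K (F ∘ suc) _)

  attach-piece : ∀ B K F f i → F i ⊑ attach B K F f
  attach-piece B (suc K) F f zero    = ⊑-trans (Join.right⊑ B (f zero) (F zero)) (attach-base _ K (F ∘ suc) _)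
  attach-piece B (suc K) F f (suc i) = attach-piece _ K (F ∘ suc) _ i

  attach-all : ∀ R B K F f → AllBags R B → (∀ i → AllBags R (F i)) → AllBags R (attach B K F f)
  attach-all R B zero    F f allB allF = allB
  attach-all R B (suc K) F f allB allF =
    attach-all R _ K (F ∘ suc) _ (Join.joined-all B (f zero) (F zero) R allB (allF zero)) (allF ∘ suc)

  attach-subtree : ∀ B K F f → SubtreeProperty B → (∀ i → SubtreeProperty (F i)) →
    (∀ i → SharedThrough B (f i) (F i)) →
    (∀ i i′ → i ≢ i′ → ∀ v s t → v ∈ bag (F i′) t → v ∈ bag (F i) s →
                                  v ∈ bag B (f i) × v ∈ bag (F i) zero) →
    SubtreeProperty (attach B K F f)
  attach-subtree B zero    F f subB subF baseShared pieceShared = subB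
  attach-subtree B (suc K) F f subB subF baseShared pieceShared =
    attach-subtree joined K (F ∘ suc) _
      (joined-subtree subB (subF zero) (baseShared zero)) (subF ∘ suc) baseShared′ pieceShared′
    where
      open Join B (f zero) (F zero)

      baseShared′ : ∀ i → SharedThrough joined (inl (f (suc i))) (F (suc i))
      baseShared′ i v s t vs vt with bag-cases s
      ... | inj₁ (x , e) = let (va , v0) = baseShared (suc i) v x t (subst (v ∈_) e vs) vt in intoL va , v0
      ... | inj₂ (y , e) =
        let (va , v0) = pieceShared (suc i) zero (λ ()) v t y (subst (v ∈_) e vs) vt in intoL va , v0
      pieceShared′ : ∀ i i′ → i ≢ i′ → ∀ v s t → v ∈ bag (F (suc i′)) t → v ∈ bag (F (suc i)) s →
                     v ∈ bag joined (inl (f (suc i))) × v ∈ bag (F (suc i)) zero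
      pieceShared′ i i′ i≢i′ v s t vt vs =
        let (va , v0) = pieceShared (suc i) (suc i′) (i≢i′ ∘ Fin-suc-injective) v s t vt vs in intoL va , v0

-- Words ordered by extension: c ≼ x when x = u ++ c for some u.  In the
-- boost, c ≼ x says that vertex x lies in the part hanging below c.

module _ {L : Set} where

  data _≼_ (c : List L) : List L → Set where
    ≼-refl : c ≼ c
    ≼-cons : ∀ {x} p → c ≼ x → c ≼ (p ∷ x)

  ≼-length : ∀ {c x} → c ≼ x → length c ≤ length x
  ≼-length ≼-refl       = ≤-refl
  ≼-length (≼-cons p d) = m≤n⇒m≤1+n (≼-length d)

  []≼ : ∀ x → [] ≼ x
  []≼ []      = ≼-refl
  []≼ (p ∷ x) = ≼-cons p ([]≼ x)

  ≼-parent : ∀ {p c x} → (p ∷ c) ≼ x → c ≼ x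
  ≼-parent ≼-refl       = ≼-cons _ ≼-refl
  ≼-parent (≼-cons q d) = ≼-cons q (≼-parent d)

  child⋠parent : ∀ {p c} → ¬ (p ∷ c) ≼ c
  child⋠parent d = 1+n≰n (≼-length d)

  ≼-unique : ∀ {c c′ x} → c ≼ x → c′ ≼ x → length c ≡ length c′ → c ≡ c′
  ≼-unique ≼-refl        ≼-refl        _ = refl
  ≼-unique ≼-refl        (≼-cons _ d′) e = ⊥-elim (1+n≰n (subst (_≤ _) (sym e) (≼-length d′)))
  ≼-unique (≼-cons _ d)  ≼-refl        e = ⊥-elim (1+n≰n (subst (_≤ _) e (≼-length d)))
  ≼-unique (≼-cons _ d)  (≼-cons _ d′) e = ≼-unique d d′ e

  ≼-view : ∀ {c x} → c ≼ x → x ≡ c ⊎ ∃ λ p → (p ∷ c) ≼ x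
  ≼-view ≼-refl = inj₁ refl
  ≼-view (≼-cons p d) with ≼-view d
  ... | inj₁ refl     = inj₂ (p , ≼-refl)
  ... | inj₂ (q , d′) = inj₂ (q , ≼-cons p d′)

module BoostDecomposition {n : ℕ} (U : Graph (Fin n)) (h m k : ℕ) (td : TreeDecomposition U k) where

  open TreeDecomposition td using ()
    renaming (N to NU; tree to treeU; bag to bagU; width≤ to widthU;
              vertex to vertexU; edge to edgeU; subtree to subtreeU)

  Vertex : Set
  Vertex = BoostV n h m

  Copy : Set
  Copy = Fin (suc (h * m))

  word : Vertex → List (BoostLabel n h m)
  word = proj₁

  -- A vertex is determined by its word (the length bound is proof-irrelevant).
  word-injective : ∀ {x y} → word x ≡ word y → x ≡ y
  word-injective {w , b} {.w , b′} refl = cong (w ,_) (≤-irrelevant b b′)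

  Narrow : List Vertex → Set
  Narrow l = length l ≤ suc (suc k)

  copyOf : (c : Vertex) → suc (length (word c)) ≤ m → Copy → Fin n → Vertex
  copyOf c fits j v = (j , v) ∷ word c , fits

  home : Fin n → Fin (suc NU)
  home v = proj₁ (vertexU v)

  module CopyBags (c : Vertex) (fits : suc (length (word c)) ≤ m) (j : Copy) where

    bags : BaggedTree Vertex
    bags = bagged NU treeU (λ t → c ∷ map (copyOf c fits j) (bagU t))

    member : ∀ {x t} → x ∈ bag bags t → x ≡ c ⊎ ∃ λ u → u ∈ bagU t × x ≡ copyOf c fits j u
    member (here x≡c) = inj₁ x≡c
    member (there m)  = inj₂ (∈-map⁻ (copyOf c fits j) m)

    copy∈ : ∀ {u t} → u ∈ bagU t → copyOf c fits j u ∈ bag bags t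
    copy∈ m = there (∈-map⁺ (copyOf c fits j) m)

    home∈ : ∀ v → copyOf c fits j v ∈ bag bags (home v)
    home∈ v = copy∈ (proj₂ (vertexU v))

    narrow : AllBags Narrow bags
    narrow t = s≤s (subst (_≤ suc k) (sym (length-map (copyOf c fits j) (bagU t))) (widthU t))

    near : AllBags (All (λ x → x ≡ c ⊎ ∃ λ v → word (copyOf c fits j v) ≼ word x)) bags
    near t = inj₁ refl ∷ All.tabulate λ m → let (v , _ , e) = ∈-map⁻ (copyOf c fits j) m in
               inj₂ (v , subst (λ x → word (copyOf c fits j v) ≼ word x) (sym e) ≼-refl)

    edge : ∀ {u v} → Adj U u v → Covered bags (copyOf c fits j u) (copyOf c fits j v)
    edge a = let (t , ut , vt) = edgeU _ _ a in t , copy∈ ut , copy∈ vt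

    subtree : SubtreeProperty bags
    subtree x s t xs xt with member xs | member xt
    ... | inj₁ x≡c | _        = weakenWalk (λ _ → here x≡c) (connected treeU s t)
    ... | inj₂ _   | inj₁ x≡c = weakenWalk (λ _ → here x≡c) (connected treeU s t)
    ... | inj₂ (u , us , refl) | inj₂ (.u , ut , refl) = weakenWalk copy∈ (subtreeU u s t us ut)

  -- Depth bookkeeping: c has d + 1 levels left below it, so its copies fit.
  copiesFit : ∀ d (c : Vertex) → suc d + length (word c) ≡ m → suc (length (word c)) ≤ m
  copiesFit d c e = subst (suc (length (word c)) ≤_) e (s≤s (m≤n+m (length (word c)) d))

  copiesDepth : ∀ d (c : Vertex) → suc d + length (word c) ≡ m → d + suc (length (word c)) ≡ m
  copiesDepth d c e = trans (+-suc d (length (word c))) e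

  copyPart : (c : Vertex) (fits : suc (length (word c)) ≤ m) (j : Copy) →
             (Fin n → BaggedTree Vertex) → BaggedTree Vertex
  copyPart c fits j subParts = attach (CopyBags.bags c fits j) n subParts home

  -- The decomposition of the part below c, where c has d levels below it.
  D : (d : ℕ) (c : Vertex) → d + length (word c) ≡ m → BaggedTree Vertex
  D zero    c e = singleton c
  D (suc d) c e = attach (singleton c) (suc (h * m))
    (λ j → copyPart c (copiesFit d c e) j λ v → D d (copyOf c (copiesFit d c e) j v) (copiesDepth d c e))
    (λ _ → zero)

  record Good (c : Vertex) (P : BaggedTree Vertex) : Set where
    field
      narrow      : AllBags Narrow P
      subtree     : SubtreeProperty P
      below       : AllBags (All (λ x → word c ≼ word x)) P
      root        : c ∈ bag P zero
      parentEdges : ∀ x y p → word y ≡ p ∷ word x → word c ≼ word x → Covered P x y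
      copyEdges   : ∀ x y w j u v → Adj U u v → word x ≡ (j , u) ∷ w → word y ≡ (j , v) ∷ w →
                    word c ≼ w → Covered P x y
  open Good

  nothingBelow : ∀ {c : Vertex} {w} → length (word c) ≡ m → word c ≼ w → ∀ y p → word y ≢ p ∷ w
  nothingBelow {w = w} e d y p ey =
    1+n≰n (≤-trans (subst (_≤ m) (cong length ey) (proj₂ y)) (subst (_≤ length w) e (≼-length d)))

  goodLeaf : ∀ c (e : 0 + length (word c) ≡ m) → Good c (D zero c e)
  goodLeaf c e = record
    { narrow      = λ _ → s≤s z≤n
    ; subtree     = singleton-subtree c
    ; below       = λ _ → ≼-refl ∷ []
    ; root        = here refl
    ; parentEdges = λ x y p ey d → ⊥-elim (nothingBelow {c} e d y p ey)
    ; copyEdges   = λ x y w j u v _ ex _ d → ⊥-elim (nothingBelow {c} e d x (j , u) ex)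
    }

  module Step (d : ℕ) (c : Vertex) (e : suc d + length (word c) ≡ m)
              (IH : ∀ j v → Good (copyOf c (copiesFit d c e) j v)
                                 (D d (copyOf c (copiesFit d c e) j v) (copiesDepth d c e))) where

    fits : suc (length (word c)) ≤ m
    fits = copiesFit d c e

    ch : Copy → Fin n → Vertex
    ch = copyOf c fits

    Sub : Copy → Fin n → BaggedTree Vertex
    Sub j v = D d (ch j v) (copiesDepth d c e)

    E : Copy → BaggedTree Vertex
    E j = copyPart c fits j (Sub j)

    atRoot : Copy → Node (singleton c)
    atRoot _ = zero

    P : BaggedTree Vertex
    P = attach (singleton c) (suc (h * m)) E atRoot

    Near : Copy → Vertex → Set
    Near j x = x ≡ c ⊎ ∃ λ v → word (ch j v) ≼ word x

    E-root : ∀ j → c ∈ bag (E j) zero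
    E-root j = subst (c ∈_) (sym (attach-root (CopyBags.bags c fits j) n (Sub j) home)) (here refl)

    E-narrow : ∀ j → AllBags Narrow (E j)
    E-narrow j = attach-all Narrow _ n (Sub j) home (CopyBags.narrow c fits j) (narrow ∘ IH j)

    E-near : ∀ j → AllBags (All (Near j)) (E j)
    E-near j = attach-all (All (Near j)) _ n (Sub j) home (CopyBags.near c fits j)
                 (λ v t → All.map (λ dv → inj₂ (v , dv)) (below (IH j v) t))

    -- Below distinct vertices of copy j the pieces are disjoint, and the
    -- piece below v meets the copy only in the copy of v itself.
    E-subtree : ∀ j → SubtreeProperty (E j)
    E-subtree j = attach-subtree _ n (Sub j) home (CopyBags.subtree c fits j) (subtree ∘ IH j) shared disjoint
      where
        open CopyBags c fits j using (bags; member; home∈)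

        shared : ∀ v → SharedThrough bags (home v) (Sub j v)
        shared v x s t xs xt with member xs
        ... | inj₁ refl = ⊥-elim (child⋠parent (All.lookup (below (IH j v) t) xt))
        ... | inj₂ (u , _ , refl) with ≼-unique (All.lookup (below (IH j v) t) xt) ≼-refl refl
        ...   | refl = home∈ v , root (IH j v)

        disjoint : ∀ v v′ → v ≢ v′ → ∀ x s t → x ∈ bag (Sub j v′) t → x ∈ bag (Sub j v) s →
                   x ∈ bag bags (home v) × x ∈ bag (Sub j v) zero
        disjoint v v′ v≢v′ x s t xt xs
          with ≼-unique (All.lookup (below (IH j v) s) xs) (All.lookup (below (IH j v′) t) xt) refl
        ... | refl = ⊥-elim (v≢v′ refl)

    -- Distinct copies meet only in c.
    P-subtree : SubtreeProperty P
    P-subtree = attach-subtree (singleton c) _ E atRoot (singleton-subtree c) E-subtree shared disjoint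
      where
        shared : ∀ j → SharedThrough (singleton c) zero (E j)
        shared j x zero t (here refl) _ = here refl , E-root j

        disjoint : ∀ j j′ → j ≢ j′ → ∀ x s t → x ∈ bag (E j′) t → x ∈ bag (E j) s →
                   x ∈ c ∷ [] × x ∈ bag (E j) zero
        disjoint j j′ j≢j′ x s t xt xs with All.lookup (E-near j s) xs | All.lookup (E-near j′ t) xt
        ... | inj₁ refl     | _              = here refl , E-root j
        ... | inj₂ _        | inj₁ refl      = here refl , E-root j
        ... | inj₂ (v , dv) | inj₂ (v′ , dv′) with ≼-unique dv dv′ refl
        ...   | refl = ⊥-elim (j≢j′ refl)

    copy⊑P : ∀ j → CopyBags.bags c fits j ⊑ P
    copy⊑P j = ⊑-trans (attach-base _ n (Sub j) home) (attach-piece (singleton c) _ E atRoot j)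

    Sub⊑P : ∀ j v → Sub j v ⊑ P
    Sub⊑P j v = ⊑-trans (attach-piece _ n (Sub j) home v) (attach-piece (singleton c) _ E atRoot j)

    nearBelow : ∀ {j x} → Near j x → word c ≼ word x
    nearBelow (inj₁ refl)     = ≼-refl
    nearBelow (inj₂ (_ , dv)) = ≼-parent dv

    -- An edge hanging from c itself is covered by a copy's bags; an edge
    -- further down, by the decomposition below the copy vertex above it.
    P-parentEdges : ∀ x y p → word y ≡ p ∷ word x → word c ≼ word x → Covered P x y
    P-parentEdges x y (j , v) ey dx with ≼-view dx
    ... | inj₂ ((j′ , v′) , dv) = covered-⊑ (Sub⊑P j′ v′) (parentEdges (IH j′ v′) x y (j , v) ey dv)
    ... | inj₁ ex with word-injective {x} {c} ex | word-injective {y} {ch j v} (trans ey (cong ((j , v) ∷_) ex))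
    ...   | refl | refl = covered-⊑ (copy⊑P j) (home v , here refl , CopyBags.home∈ c fits j v)

    P-copyEdges : ∀ x y w j u v → Adj U u v → word x ≡ (j , u) ∷ w → word y ≡ (j , v) ∷ w →
                  word c ≼ w → Covered P x y
    P-copyEdges x y w j u v a ex ey dw with ≼-view dw
    ... | inj₂ ((j′ , v′) , dv) = covered-⊑ (Sub⊑P j′ v′) (copyEdges (IH j′ v′) x y w j u v a ex ey dv)
    ... | inj₁ refl with word-injective {x} {ch j u} ex | word-injective {y} {ch j v} ey
    ...   | refl | refl = covered-⊑ (copy⊑P j) (CopyBags.edge c fits j a)

    good : Good c P
    good = record
      { narrow      = attach-all Narrow (singleton c) _ E atRoot (λ _ → s≤s z≤n) E-narrow
      ; subtree     = P-subtree
      ; below       = attach-all (All (λ x → word c ≼ word x)) (singleton c) _ E atRoot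
                        (λ _ → ≼-refl ∷ []) (λ j t → All.map nearBelow (E-near j t))
      ; root        = subst (c ∈_) (sym (attach-root (singleton c) _ E atRoot)) (here refl)
      ; parentEdges = P-parentEdges
      ; copyEdges   = P-copyEdges
      }

  good : ∀ d c e → Good c (D d c e)
  good zero    c e = goodLeaf c e
  good (suc d) c e = Step.good d c e (λ j v → good d _ (copiesDepth d c e))

  rootVertex : Vertex
  rootVertex = [] , z≤n

  decomposition : BaggedTree Vertex
  decomposition = D m rootVertex (+-identityʳ m)

  goodRoot : Good rootVertex decomposition
  goodRoot = good m rootVertex (+-identityʳ m)

  -- Every vertex is the root or the lower end of an edge to its parent.
  vertexCovered : ∀ x → ∃ λ t → x ∈ bag decomposition t
  vertexCovered ([] , b)    = zero , subst (_∈ bag decomposition zero) (word-injective refl) (root goodRoot)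
  vertexCovered (p ∷ w , b) =
    let (t , _ , x∈) = parentEdges goodRoot (w , ≤-trans (n≤1+n _) b) (p ∷ w , b) p refl ([]≼ w) in t , x∈

  edgeCovered : ∀ x y → Adj (boost U h m) x y → Covered decomposition x y
  edgeCovered (_ , bx) (_ , by) (parent w j v)   = parentEdges goodRoot (w , bx) (_ , by) (j , v) refl ([]≼ w)
  edgeCovered (_ , bx) (_ , by) (child w j v)    =
    let (t , y∈ , x∈) = parentEdges goodRoot (w , by) (_ , bx) (j , v) refl ([]≼ w) in t , x∈ , y∈
  edgeCovered (_ , bx) (_ , by) (copy w j u v a) = copyEdges goodRoot (_ , bx) (_ , by) w j u v a refl refl ([]≼ w)

-- tw(U^(h,m)) ≤ tw(U) + 1 (the bound holds for all h and m).
lemma21 : ∀ {n : ℕ} (U : Graph (Fin n)) (h m : ℕ) → 1 ≤ h → 1 ≤ m →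
            ∀ (k : ℕ) → TwAtMost U k → TwAtMost (boost U h m) (suc k)
lemma21 U h m _ _ k td = record
  { N       = N decomposition
  ; tree    = tree decomposition
  ; bag     = bag decomposition
  ; width≤  = Good.narrow goodRoot
  ; vertex  = vertexCovered
  ; edge    = edgeCovered
  ; subtree = Good.subtree goodRoot
  }
  where open BoostDecomposition U h m k td
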